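{- If $T$ is a tree on $n \equiv 1 \pmod 3$ vertices, then $R(T, \mathbb{Z}_3) \leq n + 2$.
   Context: For a graph $G$ on $n$ vertices with $3 \mid e(G)$, $R(G, \mathbb{Z}_3)$ is the smallest positive integer such that for every $N \geq R(G,\mathbb{Z}_3)$ and every edge-colouring $f\colon E(K_N) \to \mathbb{Z}_3$, there is a subgraph of $K_N$ isomorphic to $G$ whose edge colours sum to $0$ in $\mathbb{Z}_3$. -}

module Defs where

open import Data.Nat using (ℕ; zero; suc; _+_; _≤_; _%_)
open import Data.Fin using (Fin; toℕ; _<_; _<?_)
open import Data.List using (List; []; _∷_; length; concatMap; map; filter; allFin; last)
open import Data.Nat.ListAction using (sum)
open import Data.List.Relation.Unary.Unique.Propositional using (Unique)
open import Data.Maybe using (just)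
open import Data.Product using (_×_; Σ; ∃; _,_)
open import Relation.Binary.PropositionalEquality using (_≡_; _≢_)
open import Relation.Nullary using (¬_; Dec)
open import Relation.Nullary.Decidable using (_×-dec_)
open import Function.Definitions using (Injective)

record Graph (n : ℕ) : Set₁ where
  field
    Adj    : Fin n → Fin n → Set
    adj?   : (u v : Fin n) → Dec (Adj u v)
    sym    : ∀ {u v} → Adj u v → Adj v u
    irrefl : ∀ {u} → ¬ Adj u u

open Graph public

-- Edge list: each edge {u,v} listed once as (u , v) with u < v.
edges : ∀ {n} → Graph n → List (Fin n × Fin n)
edges {n} G =
  filter (λ p → let (u , v) = p in (u <? v) ×-dec adj? G u v)
    (concatMap (λ u → map (λ v → (u , v)) (allFin n)) (allFin n))

e : ∀ {n} → Graph n → ℕ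
e G = length (edges G)

data Walk {n} (G : Graph n) : Fin n → Fin n → Set where
  here : ∀ {u} → Walk G u u
  step : ∀ {u w v} → Adj G u w → Walk G w v → Walk G u v

Connected : ∀ {n} → Graph n → Set
Connected {n} G = (u v : Fin n) → Walk G u v

data Chain {n} (G : Graph n) : List (Fin n) → Set where
  []  : Chain G []
  [_] : ∀ u → Chain G (u ∷ [])
  _∷_ : ∀ {u v vs} → Adj G u v → Chain G (v ∷ vs) → Chain G (u ∷ v ∷ vs)

Cycle : ∀ {n} → Graph n → Set
Cycle {n} G = Σ (Fin n) λ v₀ → Σ (List (Fin n)) λ vs → Σ (Fin n) λ vk →
  (3 ≤ length (v₀ ∷ vs)) × Unique (v₀ ∷ vs) × Chain G (v₀ ∷ vs)
  × (last (v₀ ∷ vs) ≡ just vk) × Adj G vk v₀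

Acyclic : ∀ {n} → Graph n → Set
Acyclic G = ¬ Cycle G

IsTree : ∀ {n} → Graph n → Set
IsTree G = Connected G × Acyclic G

-- A ℤ₃-edge-colouring of K_N: a symmetric function on pairs of vertices
-- (values on the diagonal are irrelevant since K_N has no loops).
Colouring : ℕ → Set
Colouring N = Σ (Fin N → Fin N → Fin 3) λ c → ∀ i j → c i j ≡ c j i

-- A copy of G in K_N is given by an injective vertex map φ; its edges are φ(u)φ(v), uv ∈ E(G).
-- Zero-sum copy: the colours of its edges sum to 0 in ℤ₃.
ZeroSumCopy : ∀ {n N} → Graph n → Colouring N → Set
ZeroSumCopy {n} {N} G (c , _) =
  Σ (Fin n → Fin N) λ φ → Injective _≡_ _≡_ φ ×
    (sum (map (λ p → let (u , v) = p in toℕ (c (φ u) (φ v))) (edges G)) % 3 ≡ 0)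

RamseyZ3≤ : ∀ {n} → Graph n → ℕ → Set
RamseyZ3≤ G R = ∀ N → R ≤ N → (f : Colouring N) → ZeroSumCopy G f

module Submission where

-- A tree on n ≡ 1 (mod 3) vertices has n − 1 ≡ 0 (mod 3) edges, so every monochromatic copy of T is
-- zero-sum. Fix leaves ℓ, u of T with neighbours p, q. A copy of T in K_{n+2} misses exactly two vertices
-- b, r, and moving ℓ to b, or u to r, changes its weight by a difference of two colours seen from the image
-- of p, resp. q. The four copies obtained this way have weights w, w + δ, w + ε, w + δ + ε; if none of them
-- is zero and δ ≢ 0, then w and w + ε are both forced to equal δ, so ε ≡ 0. Call the two edges Pa, Pb a
-- cherry (P; a, b), bichromatic if their colours differ. Without a zero-sum copy, therefore, at most one of
-- two vertex-disjoint cherries is bichromatic when p ≢ q, and at most one of two cherries with a common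
-- centre and disjoint ends when T is a star with centre p = q. A short case analysis turns a bichromatic
-- cherry into n vertices spanning a monochromatic clique, resp. into a vertex joined to n − 1 others in a
-- single colour; either yields a monochromatic copy of T. So no cherry is bichromatic, and then K_{n+2}
-- itself is monochromatic.

open import Defs hiding (sym)
open import Algebra.Properties.CommutativeMonoid.Sum as Sum using ()
open import Data.Bool using (Bool; true; false; if_then_else_)
open import Data.Empty using (⊥; ⊥-elim)
open import Data.Fin using (Fin; zero; suc; toℕ; _<?_; _≟_; punchIn; punchOut; inject≤)
import Data.Fin as Fin
open import Data.Fin.Permutation.Components using (transpose; transpose-inverse)
open import Data.Fin.Properties
  using (toℕ-injective; toℕ-fromℕ<; suc-injective; punchIn-injective; punchIn-punchOut; punchInᵢ≢i;
         punchIn-mono-≤; punchIn-cancel-≤; <-asym; injective⇒≤; ¬∀⟶∃¬; any?; all?; inject≤-injective)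
open import Data.List using (List; []; _∷_; _++_; map; filter; concatMap; allFin; tabulate; length; last; lookup)
open import Data.List.Properties
  using (map-++; map-tabulate; map-∘; map-cong; length-map; last-map; ++-assoc; length-++)
open import Data.List.Membership.Propositional using (_∈_)
open import Data.List.Membership.Propositional.Properties using (∈-∃++; ∈-lookup)
open import Data.List.Membership.Setoid.Properties using (index-injective)
open import Data.List.Relation.Binary.Subset.Propositional using (_⊆_)
open import Data.List.Relation.Unary.All as All using (All; []; _∷_)
import Data.List.Relation.Unary.All.Properties as All
open import Data.List.Relation.Unary.AllPairs as AllPairs using (AllPairs; []; _∷_)
import Data.List.Relation.Unary.AllPairs.Properties as AllPairs
open import Data.List.Relation.Unary.Any using (here; there)
open import Data.List.Relation.Unary.Unique.Propositional using (Unique)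
import Data.List.Relation.Unary.Unique.Propositional.Properties as Unique
open import Data.Maybe as Maybe using (just)
open import Data.Nat using (ℕ; _+_; _*_; _%_; _≤_; _<_; z≤n; s≤s)
import Data.Nat as ℕ
open import Data.Nat.DivMod using (_mod_; %-distribˡ-+; m%n%n≡m%n)
open import Data.Nat.Divisibility using (m%n≡0⇒n∣m; n∣m⇒m%n≡0; ∣m⇒∣m*n)
open import Data.Nat.ListAction using (sum)
open import Data.Nat.ListAction.Properties using (sum-++)
open import Data.Nat.Properties
  using (+-0-commutativeMonoid; +-identityʳ; +-assoc; +-suc; +-comm; ≤-trans; ≤∧≢⇒<; ≰⇒>; <⇒≱; ≮⇒≥;
         1+n≰n; m≤m+n; m≤n+m)
open import Data.Product using (_×_; _,_; Σ; ∃; ∃₂; proj₁; proj₂; uncurry)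
open import Data.Sum using (_⊎_; inj₁; inj₂)
open import Data.Unit using (⊤; tt)
open import Data.Vec.Functional as Vector using (updateAt)
open import Data.Vec.Functional.Properties using (updateAt-updates; updateAt-minimal)
open import Function using (_∘_; id; const)
open import Function.Bundles using (mk⇔)
open import Function.Definitions using (Injective)
open import Relation.Binary.PropositionalEquality
  using (_≡_; _≢_; _≗_; ≢-sym; refl; sym; trans; cong; cong₂; subst; subst₂; setoid; module ≡-Reasoning)
open import Relation.Nullary using (¬_; Dec; yes; no; does)
open import Relation.Nullary.Decidable
  using (True; toWitness; from-yes; decidable-stable; map′; dec-true; dec-false; does-⇔; ¬?; _×-dec_; _→-dec_)

open Sum +-0-commutativeMonoid using (sum-remove; ∑-distrib-+; sum-cong-≗; sum-replicate-zero) renaming (sum to ∑)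

-- Sums over the edges of a graph

sum-map-filter : ∀ {A : Set} {P : A → Set} (P? : ∀ x → Dec (P x)) (f : A → ℕ) (xs : List A) →
  sum (map f (filter P? xs)) ≡ sum (map (λ x → if does (P? x) then f x else 0) xs)
sum-map-filter P? f []       = refl
sum-map-filter P? f (x ∷ xs) with does (P? x)
... | false = sum-map-filter P? f xs
... | true  = cong (f x +_) (sum-map-filter P? f xs)

sum-map-concatMap : ∀ {A B : Set} (g : A → List B) (f : B → ℕ) (xs : List A) →
  sum (map f (concatMap g xs)) ≡ sum (map (sum ∘ map f ∘ g) xs)
sum-map-concatMap g f []       = refl
sum-map-concatMap g f (x ∷ xs) = begin
  sum (map f (g x ++ concatMap g xs))                ≡⟨ cong sum (map-++ f (g x) _) ⟩
  sum (map f (g x) ++ map f (concatMap g xs))        ≡⟨ sum-++ (map f (g x)) _ ⟩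
  sum (map f (g x)) + sum (map f (concatMap g xs))   ≡⟨ cong (sum (map f (g x)) +_) (sum-map-concatMap g f xs) ⟩
  sum (map f (g x)) + sum (map (sum ∘ map f ∘ g) xs) ∎
  where open ≡-Reasoning

sum-map-allFin : ∀ {n} (f : Fin n → ℕ) → sum (map f (allFin n)) ≡ ∑ f
sum-map-allFin f = trans (cong sum (map-tabulate id f)) (sum-tabulate f)
  where
  sum-tabulate : ∀ {m} (g : Fin m → ℕ) → sum (tabulate g) ≡ ∑ g
  sum-tabulate {ℕ.zero}  g = refl
  sum-tabulate {ℕ.suc m} g = cong (g zero +_) (sum-tabulate (g ∘ suc))

∑-pointSupported : ∀ {n} (f : Fin n → ℕ) (i : Fin n) → (∀ j → j ≢ i → f j ≡ 0) → ∑ f ≡ f i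
∑-pointSupported {ℕ.suc n} f i f≡0 = begin
  ∑ f                     ≡⟨ sum-remove {i = i} f ⟩
  f i + ∑ (f ∘ punchIn i) ≡⟨ cong (f i +_) (sum-cong-≗ (λ j → f≡0 (punchIn i j) (punchInᵢ≢i i j))) ⟩
  f i + ∑ {n} (const 0)   ≡⟨ cong (f i +_) (sum-replicate-zero n) ⟩
  f i + 0                 ≡⟨ +-identityʳ (f i) ⟩
  f i                     ∎
  where open ≡-Reasoning

module _ {n : ℕ} (G : Graph n) where

  ordEdge : Fin n → Fin n → Bool
  ordEdge u v = does ((u <? v) ×-dec adj? G u v)

  edgeSum : (Fin n → Fin n → ℕ) → ℕ
  edgeSum H = sum (map (uncurry H) (edges G))

  edgeSum≡∑∑ : ∀ H → edgeSum H ≡ ∑ (λ u → ∑ (λ v → if ordEdge u v then H u v else 0))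
  edgeSum≡∑∑ H = begin
    sum (map (uncurry H) (filter _ pairs))               ≡⟨ sum-map-filter _ (uncurry H) pairs ⟩
    sum (map (uncurry entry) (concatMap row (allFin n))) ≡⟨ sum-map-concatMap row (uncurry entry) (allFin n) ⟩
    sum (map rowSum (allFin n))                          ≡⟨ sum-map-allFin rowSum ⟩
    ∑ rowSum                                             ≡⟨ sum-cong-≗ rowSum≡ ⟩
    ∑ (λ u → ∑ (entry u))                                ∎
    where
    open ≡-Reasoning
    entry : Fin n → Fin n → ℕ
    entry u v = if ordEdge u v then H u v else 0
    row : Fin n → List (Fin n × Fin n)
    row u = map (u ,_) (allFin n)
    pairs : List (Fin n × Fin n)
    pairs = concatMap row (allFin n)
    rowSum : Fin n → ℕ
    rowSum u = sum (map (uncurry entry) (row u))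
    rowSum≡ : ∀ u → rowSum u ≡ ∑ (entry u)
    rowSum≡ u = trans (cong sum (sym (map-∘ (allFin n)))) (sum-map-allFin (entry u))

  edges-Adj : All (λ (u , v) → Adj G u v) (edges G)
  edges-Adj = All.map proj₂
    (All.all-filter (λ (u , v) → (u <? v) ×-dec adj? G u v) (concatMap (λ u → map (u ,_) (allFin n)) (allFin n)))

  e≡edgeSum-1 : e G ≡ edgeSum (λ _ _ → 1)
  e≡edgeSum-1 = sym (sum-map-1 (edges G))
    where
    sum-map-1 : ∀ {A : Set} (xs : List A) → sum (map (const 1) xs) ≡ length xs
    sum-map-1 []       = refl
    sum-map-1 (_ ∷ xs) = cong ℕ.suc (sum-map-1 xs)

  ordEdge-¬Adj : ∀ {u v} → ¬ Adj G u v → ordEdge u v ≡ false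
  ordEdge-¬Adj {u} {v} ¬uv = dec-false ((u <? v) ×-dec adj? G u v) (¬uv ∘ proj₂)

  ordEdge-Adj : ∀ {u v} → u Fin.< v → Adj G u v → ordEdge u v ≡ true
  ordEdge-Adj {u} {v} u<v uv = dec-true ((u <? v) ×-dec adj? G u v) (u<v , uv)

  ordEdge-exactlyOnce : ∀ {u v} → u ≢ v → Adj G u v → (H : Fin n → Fin n → ℕ) → (∀ x y → H x y ≡ H y x) →
    (if ordEdge u v then H u v else 0) + (if ordEdge v u then H v u else 0) ≡ H v u
  ordEdge-exactlyOnce {u} {v} u≢v uv H H-sym with u <? v
  ... | yes u<v rewrite ordEdge-Adj u<v uv | dec-false ((v <? u) ×-dec adj? G v u) (<-asym u<v ∘ proj₁)
    = trans (+-identityʳ (H u v)) (H-sym u v)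
  ... | no u≮v rewrite dec-false ((u <? v) ×-dec adj? G u v) (u≮v ∘ proj₁)
                     | ordEdge-Adj (≤∧≢⇒< (≮⇒≥ u≮v) (u≢v ∘ sym ∘ toℕ-injective)) (Graph.sym G uv) = refl

removeVertex : ∀ {n} → Graph (ℕ.suc n) → Fin (ℕ.suc n) → Graph n
removeVertex G ℓ = record
  { Adj    = λ i j → Adj G (punchIn ℓ i) (punchIn ℓ j)
  ; adj?   = λ i j → adj? G (punchIn ℓ i) (punchIn ℓ j)
  ; sym    = Graph.sym G
  ; irrefl = irrefl G
  }

ordEdge-removeVertex : ∀ {n} (G : Graph (ℕ.suc n)) ℓ i j →
  ordEdge G (punchIn ℓ i) (punchIn ℓ j) ≡ ordEdge (removeVertex G ℓ) i j
ordEdge-removeVertex G ℓ i j = does-⇔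
  (mk⇔ (λ (lt , a) → ≰⇒> (<⇒≱ lt ∘ punchIn-mono-≤ ℓ j i) , a)
       (λ (lt , a) → ≰⇒> (<⇒≱ lt ∘ punchIn-cancel-≤ ℓ j i) , a))
  ((punchIn ℓ i <? punchIn ℓ j) ×-dec adj? G (punchIn ℓ i) (punchIn ℓ j))
  ((i <? j) ×-dec adj? (removeVertex G ℓ) i j)

record Leaf {n} (G : Graph n) (ℓ p : Fin n) : Set where
  field
    edge          : Adj G ℓ p
    onlyNeighbour : ∀ {v} → Adj G ℓ v → v ≡ p

  leaf≢parent : ℓ ≢ p
  leaf≢parent refl = irrefl G edge

open Leaf public

module _ {n : ℕ} (G : Graph (ℕ.suc n)) {ℓ p : Fin (ℕ.suc n)} (leaf : Leaf G ℓ p) where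

  edgeSum-removeLeaf : (H : Fin (ℕ.suc n) → Fin (ℕ.suc n) → ℕ) → (∀ x y → H x y ≡ H y x) →
    edgeSum G H ≡ H p ℓ + edgeSum (removeVertex G ℓ) (λ i j → H (punchIn ℓ i) (punchIn ℓ j))
  edgeSum-removeLeaf H H-sym = begin
    edgeSum G H
      ≡⟨ edgeSum≡∑∑ G H ⟩
    ∑ (λ u → ∑ (E u))
      ≡⟨ sum-remove {i = ℓ} (λ u → ∑ (E u)) ⟩
    ∑ (E ℓ) + ∑ (λ i → ∑ (E (punchIn ℓ i)))
      ≡⟨ cong₂ _+_ row-ℓ (sum-cong-≗ (λ i → sum-remove {i = ℓ} (E (punchIn ℓ i)))) ⟩
    E ℓ p + ∑ (λ i → E (punchIn ℓ i) ℓ + ∑ (λ j → E (punchIn ℓ i) (punchIn ℓ j)))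
      ≡⟨ cong (E ℓ p +_) (∑-distrib-+ (λ i → E (punchIn ℓ i) ℓ) _) ⟩
    E ℓ p + (∑ (λ i → E (punchIn ℓ i) ℓ) + ∑ (λ i → ∑ (λ j → E (punchIn ℓ i) (punchIn ℓ j))))
      ≡⟨ cong (E ℓ p +_) (cong₂ _+_ column-ℓ (sum-cong-≗ λ i → sum-cong-≗ λ j → E-punchIn i j)) ⟩
    E ℓ p + (E p ℓ + ∑ (λ i → ∑ (λ j → E′ i j)))
      ≡⟨ sym (+-assoc (E ℓ p) (E p ℓ) _) ⟩
    E ℓ p + E p ℓ + ∑ (λ i → ∑ (λ j → E′ i j))
      ≡⟨ cong₂ _+_ (ordEdge-exactlyOnce G (leaf≢parent leaf) (edge leaf) H H-sym) (sym (edgeSum≡∑∑ G-ℓ H′)) ⟩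
    H p ℓ + edgeSum G-ℓ H′ ∎
    where
    open ≡-Reasoning
    G-ℓ : Graph n
    G-ℓ = removeVertex G ℓ
    E : Fin (ℕ.suc n) → Fin (ℕ.suc n) → ℕ
    E u v = if ordEdge G u v then H u v else 0
    H′ E′ : Fin n → Fin n → ℕ
    H′ i j = H (punchIn ℓ i) (punchIn ℓ j)
    E′ i j = if ordEdge G-ℓ i j then H′ i j else 0

    E-nonadjacent : ∀ {u v} → ¬ Adj G u v → E u v ≡ 0
    E-nonadjacent ¬uv rewrite ordEdge-¬Adj G ¬uv = refl

    row-ℓ : ∑ (E ℓ) ≡ E ℓ p
    row-ℓ = ∑-pointSupported (E ℓ) p (λ v v≢p → E-nonadjacent (v≢p ∘ onlyNeighbour leaf))

    column-ℓ : ∑ (λ i → E (punchIn ℓ i) ℓ) ≡ E p ℓ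
    column-ℓ = trans
      (∑-pointSupported (λ i → E (punchIn ℓ i) ℓ) p′
        (λ i i≢p′ → E-nonadjacent (λ a → i≢p′ (punchIn-injective ℓ i p′
          (trans (onlyNeighbour leaf (Graph.sym G a)) (sym (punchIn-punchOut (leaf≢parent leaf))))))))
      (cong (λ v → E v ℓ) (punchIn-punchOut (leaf≢parent leaf)))
      where
      p′ : Fin n
      p′ = punchOut (leaf≢parent leaf)

    E-punchIn : ∀ i j → E (punchIn ℓ i) (punchIn ℓ j) ≡ E′ i j
    E-punchIn i j = cong (if_then H′ i j else 0) (ordEdge-removeVertex G ℓ i j)

  e-removeLeaf : e G ≡ ℕ.suc (e (removeVertex G ℓ))
  e-removeLeaf = begin
    e G                                             ≡⟨ e≡edgeSum-1 G ⟩
    edgeSum G (λ _ _ → 1)                           ≡⟨ edgeSum-removeLeaf (λ _ _ → 1) (λ _ _ → refl) ⟩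
    ℕ.suc (edgeSum (removeVertex G ℓ) (λ _ _ → 1)) ≡⟨ cong ℕ.suc (sym (e≡edgeSum-1 (removeVertex G ℓ))) ⟩
    ℕ.suc (e (removeVertex G ℓ))                    ∎
    where open ≡-Reasoning

-- Trees

module _ {n : ℕ} (G : Graph (ℕ.suc n)) {ℓ p : Fin (ℕ.suc n)} (leaf : Leaf G ℓ p) where

  walk-removeLeaf : ∀ {x y} → Walk G x y → ∀ {i j} → x ≡ punchIn ℓ i → y ≡ punchIn ℓ j → Walk (removeVertex G ℓ) i j
  walk-removeLeaf here refl y≡ = subst (Walk _ _) (punchIn-injective ℓ _ _ y≡) here
  walk-removeLeaf (step {w = w} xw rest) x≡ y≡ with w ≟ ℓ
  walk-removeLeaf (step xw here) x≡ y≡ | yes refl = ⊥-elim (punchInᵢ≢i ℓ _ (sym y≡))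
  walk-removeLeaf (step xw (step ℓw′ rest)) x≡ y≡ | yes refl =
    walk-removeLeaf rest (trans (onlyNeighbour leaf ℓw′) (trans (sym (onlyNeighbour leaf (Graph.sym G xw))) x≡)) y≡
  ... | no w≢ℓ = step (subst₂ (Adj G) x≡ w≡ xw) (walk-removeLeaf rest w≡ y≡)
    where
    w≡ : w ≡ punchIn ℓ (punchOut (w≢ℓ ∘ sym))
    w≡ = sym (punchIn-punchOut (w≢ℓ ∘ sym))

  chain-punchIn : ∀ {vs} → Chain (removeVertex G ℓ) vs → Chain G (map (punchIn ℓ) vs)
  chain-punchIn []       = []
  chain-punchIn [ v ]    = [ punchIn ℓ v ]
  chain-punchIn (a ∷ as) = a ∷ chain-punchIn as

  isTree-removeLeaf : IsTree G → IsTree (removeVertex G ℓ)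
  isTree-removeLeaf (connected , acyclic) =
    (λ i j → walk-removeLeaf (connected (punchIn ℓ i) (punchIn ℓ j)) refl refl) ,
    λ (v₀ , vs , vₖ , long , unique , chain , lastₖ , closing) → acyclic
      ( punchIn ℓ v₀ , map (punchIn ℓ) vs , punchIn ℓ vₖ
      , subst (λ k → 3 ≤ ℕ.suc k) (sym (length-map (punchIn ℓ) vs)) long
      , Unique.map⁺ (punchIn-injective ℓ _ _) unique
      , chain-punchIn chain
      , trans (last-map (punchIn ℓ) (v₀ ∷ vs)) (cong (Maybe.map (punchIn ℓ)) lastₖ)
      , closing )

module _ {m : ℕ} where

  lookup-injective : ∀ {xs : List (Fin m)} → Unique xs → ∀ {i j} → lookup xs i ≡ lookup xs j → i ≡ j
  lookup-injective (x∉xs ∷ _) {zero}  {zero}  _  = refl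
  lookup-injective (x∉xs ∷ _) {zero}  {suc j} eq = ⊥-elim (All.lookup x∉xs (∈-lookup j) eq)
  lookup-injective (x∉xs ∷ _) {suc i} {zero}  eq = ⊥-elim (All.lookup x∉xs (∈-lookup i) (sym eq))
  lookup-injective (_ ∷ xs!)  {suc i} {suc j} eq = cong suc (lookup-injective xs! eq)

  length-Unique : ∀ {xs : List (Fin m)} → Unique xs → length xs ≤ m
  length-Unique xs! = injective⇒≤ (lookup-injective xs!)

  fresh : (xs : List (Fin m)) → length xs < m → ∃ λ s → All (s ≢_) xs
  fresh xs short with ¬∀⟶∃¬ m (_∈ xs) (_∈? xs) covers
    where
    open import Data.List.Membership.DecPropositional (_≟_ {m}) using (_∈?_)
    covers : ¬ (∀ s → s ∈ xs)
    covers all = <⇒≱ short (injective⇒≤ (λ {s} {t} → index-injective (setoid (Fin m)) (all s) (all t)))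
  ... | s , s∉xs = s , All.¬Any⇒All¬ xs s∉xs

unique-++⁻ˡ : ∀ {A : Set} (xs : List A) {ys} → Unique (xs ++ ys) → Unique xs
unique-++⁻ˡ []       _          = []
unique-++⁻ˡ (x ∷ xs) (x∉ ∷ xs!) = All.++⁻ˡ xs x∉ ∷ unique-++⁻ˡ xs xs!

last-∷ʳ : ∀ {A : Set} (xs : List A) (v : A) → last (xs ++ v ∷ []) ≡ just v
last-∷ʳ []           v = refl
last-∷ʳ (x ∷ [])     v = refl
last-∷ʳ (x ∷ y ∷ xs) v = last-∷ʳ (y ∷ xs) v

module _ {n : ℕ} (G : Graph n) where

  SimplePath : List (Fin n) → Set
  SimplePath vs = Unique vs × Chain G vs

  chain-++⁻ˡ : ∀ xs {ys} → Chain G (xs ++ ys) → Chain G xs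
  chain-++⁻ˡ []           _        = []
  chain-++⁻ˡ (x ∷ [])     _        = [ x ]
  chain-++⁻ˡ (x ∷ y ∷ xs) (a ∷ as) = a ∷ chain-++⁻ˡ (y ∷ xs) as

  chord⇒cycle : ∀ {w w′ v rest} → SimplePath (w ∷ w′ ∷ rest) → v ∈ rest → Adj G w v → Cycle G
  chord⇒cycle {w} {w′} {v} (unique , chain) v∈rest wv with ∈-∃++ v∈rest
  ... | ys , zs , refl =
    w , w′ ∷ ys ++ v ∷ [] , v ,
    s≤s (s≤s (subst (1 ≤_) (sym (length-++ ys)) (m≤n+m 1 (length ys)))) ,
    unique-++⁻ˡ cycle (subst Unique (sym split) unique) ,
    chain-++⁻ˡ cycle (subst (Chain G) (sym split) chain) ,
    last-∷ʳ (w ∷ w′ ∷ ys) v ,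
    Graph.sym G wv
    where
    cycle : List (Fin n)
    cycle = w ∷ w′ ∷ ys ++ v ∷ []
    split : cycle ++ zs ≡ w ∷ w′ ∷ ys ++ v ∷ zs
    split = cong (λ l → w ∷ w′ ∷ l) (++-assoc ys (v ∷ []) zs)

  record PathToLeaf (rest : List (Fin n)) : Set where
    field
      end parent : Fin n
      middle     : List (Fin n)
      simple     : SimplePath (end ∷ parent ∷ middle)
      isLeaf     : Leaf G end parent
      ⊇rest      : rest ⊆ middle

  module _ (acyclic : Acyclic G) where
    open import Data.List.Membership.DecPropositional (_≟_ {n}) using (_∈?_)

    -- By acyclicity a neighbour of the front other than its successor is new, so the path can be
    -- extended until its front is a leaf; the fuel k runs out only if the path had more than n vertices.
    grow : ∀ k {w w′ rest} → n ≤ k + length (w ∷ w′ ∷ rest) → SimplePath (w ∷ w′ ∷ rest) → PathToLeaf rest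
    grow k {w} {w′} {rest} bound path@(unique , chain@(ww′ ∷ _))
      with any? (λ v → adj? G w v ×-dec ¬? (v ≟ w′))
    ... | no noOther = record
      { simple = path ; ⊇rest = id
      ; isLeaf = record { edge = ww′ ; onlyNeighbour = onlyNeighbour′ } }
      where
      onlyNeighbour′ : ∀ {v} → Adj G w v → v ≡ w′
      onlyNeighbour′ {v} wv with v ≟ w′
      ... | yes v≡w′ = v≡w′
      ... | no  v≢w′ = ⊥-elim (noOther (v , wv , v≢w′))
    ... | yes (v , wv , v≢w′) with v ∈? rest
    ...   | yes v∈rest = ⊥-elim (acyclic (chord⇒cycle path v∈rest wv))
    ...   | no  v∉rest = continue k bound
      where
      longer : SimplePath (v ∷ w ∷ w′ ∷ rest)
      longer = ((λ { refl → irrefl G wv }) ∷ v≢w′ ∷ All.¬Any⇒All¬ rest v∉rest) ∷ unique , Graph.sym G wv ∷ chain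
      continue : ∀ k → n ≤ k + length (w ∷ w′ ∷ rest) → PathToLeaf rest
      continue ℕ.zero    bound = ⊥-elim (1+n≰n (≤-trans (length-Unique (proj₁ longer)) bound))
      continue (ℕ.suc k) bound = record { PathToLeaf r ; ⊇rest = PathToLeaf.⊇rest r ∘ there }
        where r = grow k (subst (n ≤_) (sym (+-suc k _)) bound) longer

    leaf-exists : Connected G → ∀ {a b : Fin n} → a ≢ b → ∃₂ λ ℓ p → Leaf G ℓ p
    leaf-exists connected {a} {b} a≢b with connected a b
    ... | here = ⊥-elim (a≢b refl)
    ... | step aw _ = PathToLeaf.end r , PathToLeaf.parent r , PathToLeaf.isLeaf r
      where
      r = grow n (m≤m+n n _) (((λ { refl → irrefl G aw }) ∷ []) ∷ [] ∷ [] , Graph.sym G aw ∷ [ a ])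

e-tree : ∀ n (T : Graph (ℕ.suc n)) → IsTree T → e T ≡ n
e-tree ℕ.zero    T _ = refl
e-tree (ℕ.suc n) T tree@(connected , acyclic) with leaf-exists T acyclic connected {zero} {suc zero} (λ ())
... | ℓ , p , leaf =
  trans (e-removeLeaf T leaf) (cong ℕ.suc (e-tree n (removeVertex T ℓ) (isTree-removeLeaf T leaf tree)))

module _ {n : ℕ} (G : Graph n) where

  Star : Fin n → Set
  Star p = ∀ {a b} → Adj G a b → a ≡ p ⊎ b ≡ p

  record DisjointLeaf {ℓ p : Fin n} (leaf : Leaf G ℓ p) : Set where
    field
      end parent : Fin n
      isLeaf     : Leaf G end parent
      ℓ≢end      : ℓ ≢ end
      ℓ≢parent   : ℓ ≢ parent
      p≢end      : p ≢ end
      p≢parent   : p ≢ parent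

  -- If p has a neighbour w ≢ ℓ with a further neighbour v ≢ p, growing the path v w p ℓ past v ends in a
  -- leaf away from ℓ and p; otherwise every edge has p as an endpoint.
  disjointLeaf-or-star : IsTree G → ∀ {ℓ p} (leaf : Leaf G ℓ p) → DisjointLeaf leaf ⊎ Star p
  disjointLeaf-or-star (connected , acyclic) {ℓ} {p} leaf
    with any? (λ w → adj? G p w ×-dec ¬? (w ≟ ℓ) ×-dec any? (λ v → adj? G w v ×-dec ¬? (v ≟ p)))
  ... | yes (w , pw , w≢ℓ , v , wv , v≢p) = inj₁ (record
        { isLeaf = isLeaf ; ℓ≢end = ≢-sym (All.lookup end∉ ℓ∈) ; ℓ≢parent = ≢-sym (All.lookup parent∉ ℓ∈)
        ; p≢end = ≢-sym (All.lookup end∉ p∈) ; p≢parent = ≢-sym (All.lookup parent∉ p∈) })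
    where
    v≢ℓ : v ≢ ℓ
    v≢ℓ refl = irrefl G (subst (Adj G p) (onlyNeighbour leaf (Graph.sym G wv)) pw)
    path : SimplePath G (v ∷ w ∷ p ∷ ℓ ∷ [])
    path = ((λ { refl → irrefl G wv }) ∷ v≢p ∷ v≢ℓ ∷ []) ∷ ((λ { refl → irrefl G pw }) ∷ w≢ℓ ∷ []) ∷
             (≢-sym (leaf≢parent leaf) ∷ []) ∷ [] ∷ []
         , Graph.sym G wv ∷ Graph.sym G pw ∷ Graph.sym G (edge leaf) ∷ [ ℓ ]
    open PathToLeaf (grow G acyclic n (m≤m+n n _) path)
    end∉ : All (end ≢_) middle
    end∉ = All.tail (AllPairs.head (proj₁ simple))
    parent∉ : All (parent ≢_) middle
    parent∉ = AllPairs.head (AllPairs.tail (proj₁ simple))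
    p∈ : p ∈ middle
    p∈ = ⊇rest (here refl)
    ℓ∈ : ℓ ∈ middle
    ℓ∈ = ⊇rest (there (here refl))
  ... | no noSecondNeighbour = inj₂ star
    where
    second-neighbour : ∀ {x z} → Adj G p x → Adj G x z → z ≡ p
    second-neighbour {x} {z} px xz with x ≟ ℓ | z ≟ p
    ... | yes refl | _       = onlyNeighbour leaf xz
    ... | no _     | yes z≡p = z≡p
    ... | no x≢ℓ   | no z≢p  = ⊥-elim (noSecondNeighbour (x , px , x≢ℓ , z , xz , z≢p))
    reach : ∀ {x y} → Walk G x y → x ≡ p ⊎ Adj G p x → y ≡ p ⊎ Adj G p y
    reach here              near        = near
    reach (step xw through) (inj₁ refl) = reach through (inj₂ xw)
    reach (step xw through) (inj₂ px)   = reach through (inj₁ (second-neighbour px xw))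
    star : Star p
    star {a} ab with reach (connected p a) (inj₁ refl)
    ... | inj₁ a≡p = inj₁ a≡p
    ... | inj₂ pa  = inj₂ (second-neighbour pa ab)

  star-leaf : Connected G → ∀ {p u} → Star p → u ≢ p → Leaf G u p
  star-leaf connected {p} {u} star u≢p with connected u p
  ... | here      = ⊥-elim (u≢p refl)
  ... | step uw _ = record { edge = subst (Adj G u) (away uw) uw ; onlyNeighbour = away }
    where
    away : ∀ {v} → Adj G u v → v ≡ p
    away uv with star uv
    ... | inj₁ u≡p = ⊥-elim (u≢p u≡p)
    ... | inj₂ v≡p = v≡p

-- Weights and zero-sum copies

module _ {n N : ℕ} (G : Graph n) (c : Fin N → Fin N → Fin 3) where

  weight : (Fin n → Fin N) → ℕ
  weight φ = edgeSum G (λ u v → toℕ (c (φ u) (φ v)))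

  weight-cong : ∀ {φ ψ} → φ ≗ ψ → weight φ ≡ weight ψ
  weight-cong φ≗ψ = cong sum (map-cong (λ (u , v) → cong₂ (λ a b → toℕ (c a b)) (φ≗ψ u) (φ≗ψ v)) (edges G))

  weight-monochromatic : ∀ {φ γ} → (∀ {u v} → Adj G u v → c (φ u) (φ v) ≡ γ) → weight φ ≡ e G * toℕ γ
  weight-monochromatic monochromatic = sum-map-const (All.map (cong toℕ ∘ monochromatic) (edges-Adj G))
    where
    sum-map-const : ∀ {xs : List (Fin n × Fin n)} {f k} → All (λ x → f x ≡ k) xs → sum (map f xs) ≡ length xs * k
    sum-map-const []             = refl
    sum-map-const (fx≡k ∷ fxs≡k) = cong₂ _+_ fx≡k (sum-map-const fxs≡k)

  monochromatic-zeroSum : e G % 3 ≡ 0 → ∀ {φ γ} → (∀ {u v} → Adj G u v → c (φ u) (φ v) ≡ γ) → weight φ % 3 ≡ 0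
  monochromatic-zeroSum e%3≡0 {φ} {γ} monochromatic = trans (cong (_% 3) (weight-monochromatic monochromatic))
    (n∣m⇒m%n≡0 (e G * toℕ γ) 3 (∣m⇒∣m*n (toℕ γ) (m%n≡0⇒n∣m (e G) 3 e%3≡0)))

module _ {n N : ℕ} (G : Graph (ℕ.suc n)) (c : Fin N → Fin N → Fin 3) (c-sym : ∀ x y → c x y ≡ c y x)
         {ℓ p : Fin (ℕ.suc n)} (leaf : Leaf G ℓ p) where

  weight-removeLeaf : ∀ φ → weight G c φ ≡ toℕ (c (φ p) (φ ℓ)) + weight (removeVertex G ℓ) c (φ ∘ punchIn ℓ)
  weight-removeLeaf φ = edgeSum-removeLeaf G leaf (λ u v → toℕ (c (φ u) (φ v))) (λ u v → cong toℕ (c-sym (φ u) (φ v)))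

  weight-moveLeaf : ∀ φ y →
    weight G c (updateAt φ ℓ (const y)) ≡ toℕ (c (φ p) y) + weight (removeVertex G ℓ) c (φ ∘ punchIn ℓ)
  weight-moveLeaf φ y = trans (weight-removeLeaf (updateAt φ ℓ (const y))) (cong₂ _+_
    (cong toℕ (cong₂ c (updateAt-minimal p ℓ φ (leaf≢parent leaf ∘ sym)) (updateAt-updates ℓ φ)))
    (weight-cong (removeVertex G ℓ) c (λ i → updateAt-minimal (punchIn ℓ i) ℓ φ (punchInᵢ≢i ℓ i))))

any-map? : ∀ {k m} {P : (Fin k → Fin m) → Set} → (∀ {φ ψ} → φ ≗ ψ → P φ → P ψ) → (∀ φ → Dec (P φ)) →
  Dec (Σ (Fin k → Fin m) P)
any-map? {ℕ.zero}  resp P? = map′ (λ p → _ , p) (λ (φ , p) → resp (λ ()) p) (P? (λ ()))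
any-map? {ℕ.suc k} resp P? =
  map′ (λ (x , ψ , p) → x Vector.∷ ψ , p)
       (λ (φ , p) → φ zero , φ ∘ suc , resp (λ { zero → refl ; (suc i) → refl }) p)
       (any? λ x → any-map? (λ ψ≗ψ′ → resp (λ { zero → refl ; (suc i) → ψ≗ψ′ i })) (λ ψ → P? (x Vector.∷ ψ)))

injective? : ∀ {k m} (φ : Fin k → Fin m) → Dec (Injective _≡_ _≡_ φ)
injective? φ = map′ (λ inj {x} {y} → inj x y) (λ inj x y → inj) (all? λ x → all? λ y → (φ x ≟ φ y) →-dec (x ≟ y))

zeroSumCopy? : ∀ {n N} (G : Graph n) (f : Colouring N) → Dec (ZeroSumCopy G f)
zeroSumCopy? G (c , _) = any-map? respects (λ φ → injective? φ ×-dec (weight G c φ % 3 ℕ.≟ 0))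
  where
  respects : ∀ {φ ψ} → φ ≗ ψ →
    Injective _≡_ _≡_ φ × weight G c φ % 3 ≡ 0 → Injective _≡_ _≡_ ψ × weight G c ψ % 3 ≡ 0
  respects φ≗ψ (φ-injective , zeroSum) =
    (λ {x} {y} eq → φ-injective (trans (φ≗ψ x) (trans eq (sym (φ≗ψ y))))) ,
    trans (cong (_% 3) (sym (weight-cong G c φ≗ψ))) zeroSum

zeroSumCopy-restrict : ∀ {n m N} (G : Graph n) (m≤N : m ≤ N) ((c , c-sym) : Colouring N) →
  ZeroSumCopy G ((λ i j → c (inject≤ i m≤N) (inject≤ j m≤N)) , (λ i j → c-sym (inject≤ i m≤N) (inject≤ j m≤N))) →
  ZeroSumCopy G (c , c-sym)
zeroSumCopy-restrict G m≤N _ (φ , φ-injective , zeroSum) =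
  (λ i → inject≤ (φ i) m≤N) , φ-injective ∘ inject≤-injective m≤N m≤N _ _ , zeroSum

-- Arithmetic modulo 3

%3-residue : ∀ k W → (k + W) % 3 ≡ (k + toℕ (W mod 3)) % 3
%3-residue k W = begin
  (k + W) % 3              ≡⟨ %-distribˡ-+ k W 3 ⟩
  (k % 3 + W % 3) % 3      ≡⟨ cong (λ r → (k % 3 + r) % 3) (sym (m%n%n≡m%n W 3)) ⟩
  (k % 3 + W % 3 % 3) % 3  ≡⟨ sym (%-distribˡ-+ k (W % 3) 3) ⟩
  (k + W % 3) % 3          ≡⟨ cong (λ r → (k + r) % 3) (sym (toℕ-fromℕ< _)) ⟩
  (k + toℕ (W mod 3)) % 3  ∎
  where open ≡-Reasoning

-- For x ≢ y the only residue r making x + r and y + r both nonzero is x + y.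
nonzero-shifts-residue : ∀ (x y r r′ : Fin 3) → x ≢ y →
  (toℕ x + toℕ r) % 3 ≢ 0 → (toℕ y + toℕ r) % 3 ≢ 0 → (toℕ x + toℕ r′) % 3 ≢ 0 → (toℕ y + toℕ r′) % 3 ≢ 0 → r ≡ r′
nonzero-shifts-residue = from-yes (all? {n = 3} λ x → all? {n = 3} λ y → all? {n = 3} λ r → all? {n = 3} λ r′ →
  ¬? (x ≟ y) →-dec nonzero? x r →-dec nonzero? y r →-dec nonzero? x r′ →-dec nonzero? y r′ →-dec r ≟ r′)
  where
  nonzero? : ∀ (x r : Fin 3) → Dec ((toℕ x + toℕ r) % 3 ≢ 0)
  nonzero? x r = ¬? ((toℕ x + toℕ r) % 3 ℕ.≟ 0)

shift-cancel : ∀ (s t r : Fin 3) → (toℕ s + toℕ r) % 3 ≡ (toℕ t + toℕ r) % 3 → s ≡ t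
shift-cancel = from-yes (all? {n = 3} λ s → all? {n = 3} λ t → all? {n = 3} λ r →
  ((toℕ s + toℕ r) % 3 ℕ.≟ (toℕ t + toℕ r) % 3) →-dec s ≟ t)

four-nonzero-weights : ∀ (x y s t : Fin 3) W W′ V → x ≢ y →
  (toℕ x + W) % 3 ≢ 0 → (toℕ y + W) % 3 ≢ 0 → (toℕ x + W′) % 3 ≢ 0 → (toℕ y + W′) % 3 ≢ 0 →
  toℕ x + W ≡ toℕ s + V → toℕ x + W′ ≡ toℕ t + V → s ≡ t
four-nonzero-weights x y s t W W′ V x≢y xW yW xW′ yW′ eq eq′ = shift-cancel s t (V mod 3) (begin
  (toℕ s + toℕ (V mod 3)) % 3   ≡⟨ sym (%3-residue (toℕ s) V) ⟩
  (toℕ s + V) % 3               ≡⟨ cong (_% 3) (sym eq) ⟩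
  (toℕ x + W) % 3               ≡⟨ %3-residue (toℕ x) W ⟩
  (toℕ x + toℕ (W mod 3)) % 3   ≡⟨ cong (λ r → (toℕ x + toℕ r) % 3) W≡W′ ⟩
  (toℕ x + toℕ (W′ mod 3)) % 3  ≡⟨ sym (%3-residue (toℕ x) W′) ⟩
  (toℕ x + W′) % 3              ≡⟨ cong (_% 3) eq′ ⟩
  (toℕ t + V) % 3               ≡⟨ %3-residue (toℕ t) V ⟩
  (toℕ t + toℕ (V mod 3)) % 3   ∎)
  where
  open ≡-Reasoning
  nonzero : ∀ k W → (k + W) % 3 ≢ 0 → (k + toℕ (W mod 3)) % 3 ≢ 0
  nonzero k W ne = ne ∘ trans (%3-residue k W)
  W≡W′ : W mod 3 ≡ W′ mod 3
  W≡W′ = nonzero-shifts-residue x y (W mod 3) (W′ mod 3) x≢y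
    (nonzero (toℕ x) W xW) (nonzero (toℕ y) W yW) (nonzero (toℕ x) W′ xW′) (nonzero (toℕ y) W′ yW′)

pred-%3 : ∀ k → ℕ.suc k % 3 ≡ 1 → k % 3 ≡ 0
pred-%3 k 1+k%3≡1 = trans (sym (toℕ-fromℕ< _)) (residue (k mod 3) (trans (sym (%3-residue 1 k)) 1+k%3≡1))
  where
  residue : ∀ (r : Fin 3) → (1 + toℕ r) % 3 ≡ 1 → toℕ r ≡ 0
  residue zero             _  = refl
  residue (suc zero)       ()
  residue (suc (suc zero)) ()

-- Injective maps

module _ {k m : ℕ} where

  updateAt-injective : ∀ {φ : Fin k → Fin m} {i y} → Injective _≡_ _≡_ φ → (∀ j → φ j ≢ y) →
    Injective _≡_ _≡_ (updateAt φ i (const y))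
  updateAt-injective {φ} {i} φ-injective φ≢y {j} {j′} eq with j ≟ i | j′ ≟ i
  ... | yes refl | yes refl = refl
  ... | yes refl | no j′≢i  =
    ⊥-elim (φ≢y j′ (sym (trans (sym (updateAt-updates i φ)) (trans eq (updateAt-minimal j′ i φ j′≢i)))))
  ... | no j≢i   | yes refl =
    ⊥-elim (φ≢y j (trans (sym (updateAt-minimal j i φ j≢i)) (trans eq (updateAt-updates i φ))))
  ... | no j≢i   | no j′≢i  =
    φ-injective (trans (sym (updateAt-minimal j i φ j≢i)) (trans eq (updateAt-minimal j′ i φ j′≢i)))

  updateAt-avoids : ∀ {φ : Fin k → Fin m} {i y b} → (∀ j → φ j ≢ b) → y ≢ b → ∀ j → updateAt φ i (const y) j ≢ b
  updateAt-avoids {φ} {i} φ≢b y≢b j with j ≟ i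
  ... | yes refl = y≢b ∘ trans (sym (updateAt-updates i φ))
  ... | no j≢i   = φ≢b j ∘ trans (sym (updateAt-minimal j i φ j≢i))

  Consistent : List (Fin k × Fin m) → Set
  Consistent = AllPairs (λ (i , x) (j , y) → i ≢ j × x ≢ y)

  Realises : (Fin k → Fin m) → List (Fin k × Fin m) → Set
  Realises φ = All (λ (i , x) → φ i ≡ x)

module _ {m : ℕ} where

  transpose-matchˡ : ∀ (i j : Fin m) → transpose i j i ≡ j
  transpose-matchˡ i j rewrite dec-true (i ≟ i) refl = refl

  transpose-other : ∀ {i j k : Fin m} → k ≢ i → k ≢ j → transpose i j k ≡ k
  transpose-other {i} {j} {k} k≢i k≢j rewrite dec-false (k ≟ i) k≢i | dec-false (k ≟ j) k≢j = refl

  transpose-injective : ∀ (i j : Fin m) → Injective _≡_ _≡_ (transpose i j)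
  transpose-injective i j eq =
    trans (sym (transpose-inverse j i)) (trans (cong (transpose j i) eq) (transpose-inverse j i))

  permutation-realising : (ps : List (Fin m × Fin m)) → Consistent ps →
    Σ (Fin m → Fin m) λ σ → Injective _≡_ _≡_ σ × Realises σ ps
  permutation-realising []             []                   = id , id , []
  permutation-realising ((i , x) ∷ ps) (apart ∷ consistent) with permutation-realising ps consistent
  ... | σ , σ-injective , σ-realises =
    transpose (σ i) x ∘ σ , σ-injective ∘ transpose-injective (σ i) x ,
    transpose-matchˡ (σ i) x ∷ keep apart σ-realises
    where
    keep : ∀ {qs} → All (λ (j , y) → i ≢ j × x ≢ y) qs → Realises σ qs → Realises (transpose (σ i) x ∘ σ) qs
    keep []                    []            = []
    keep ((i≢j , x≢y) ∷ apart) (σj≡y ∷ σ-qs) =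
      trans (cong (transpose (σ i) x) σj≡y)
            (transpose-other (λ y≡σi → i≢j (σ-injective (sym (trans σj≡y y≡σi)))) (x≢y ∘ sym))
      ∷ keep apart σ-qs

record AvoidingEmbedding {n} (ps : List (Fin n × Fin (2 + n))) (b r : Fin (2 + n)) : Set where
  field
    φ         : Fin n → Fin (2 + n)
    injective : Injective _≡_ _≡_ φ
    realises  : Realises φ ps
    avoids₁   : ∀ i → φ i ≢ b
    avoids₂   : ∀ i → φ i ≢ r

-- σ sends the two extra points 0 and 1 of Fin (2 + n) to the vertices to be avoided.
embedding-avoiding : ∀ {n} (ps : List (Fin n × Fin (2 + n))) → Consistent ps → ∀ {b r} → b ≢ r →
  All (λ (_ , x) → x ≢ b × x ≢ r) ps → AvoidingEmbedding ps b r
embedding-avoiding ps consistent {b} {r} b≢r avoid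
  with permutation-realising ((zero , b) ∷ (suc zero , r) ∷ map lift ps)
         ( (((λ ()) , b≢r) ∷ All.map⁺ (All.map (λ (x≢b , _) → (λ ()) , x≢b ∘ sym) avoid))
         ∷ All.map⁺ (All.map (λ (_ , x≢r) → (λ ()) , x≢r ∘ sym) avoid)
         ∷ AllPairs.map⁺ (AllPairs.map (λ (i≢j , x≢y) → i≢j ∘ suc-injective ∘ suc-injective , x≢y) consistent))
  where
  lift : ∀ {n} → Fin n × Fin (2 + n) → Fin (2 + n) × Fin (2 + n)
  lift (i , x) = suc (suc i) , x
... | σ , σ-injective , σ0≡b ∷ σ1≡r ∷ σ-ps = record
  { φ         = σ ∘ suc ∘ suc
  ; injective = suc-injective ∘ suc-injective ∘ σ-injective
  ; realises  = All.map⁻ σ-ps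
  ; avoids₁   = λ i eq → 0≢2+ (σ-injective (trans σ0≡b (sym eq)))
  ; avoids₂   = λ i eq → 1≢2+ (σ-injective (trans σ1≡r (sym eq)))
  }
  where
  0≢2+ : ∀ {n} {i : Fin n} → zero ≢ suc (suc i)
  0≢2+ ()
  1≢2+ : ∀ {n} {i : Fin n} → suc zero ≢ suc (suc i)
  1≢2+ ()

-- Colourings of K_{n+2} without a zero-sum copy of T

locally-constant⇒monochromatic : ∀ {N} (c : Fin N → Fin N → Fin 3) → (∀ x y → c x y ≡ c y x) → (W : Fin N → Set) →
  (∀ {Q r₁ r₂} → W Q → W r₁ → W r₂ → r₁ ≢ Q → r₂ ≢ Q → c Q r₁ ≡ c Q r₂) →
  ∀ {t₁ t₂} → W t₁ → W t₂ → t₁ ≢ t₂ → ∀ {u v} → W u → W v → u ≢ v → c u v ≡ c t₁ t₂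
locally-constant⇒monochromatic c c-sym W constant {t₁} {t₂} w₁ w₂ t₁≢t₂ {u} {v} wu wv u≢v with u ≟ t₁
... | yes refl = constant wu wv w₂ (≢-sym u≢v) (≢-sym t₁≢t₂)
... | no u≢t₁  = begin
  c u v   ≡⟨ constant wu wv w₁ (≢-sym u≢v) (≢-sym u≢t₁) ⟩
  c u t₁  ≡⟨ c-sym u t₁ ⟩
  c t₁ u  ≡⟨ constant w₁ wu w₂ u≢t₁ (≢-sym t₁≢t₂) ⟩
  c t₁ t₂ ∎
  where open ≡-Reasoning

module NoZeroSumCopy {m : ℕ} (T : Graph (4 + m)) (e%3≡0 : e T % 3 ≡ 0)
  (c : Fin (6 + m) → Fin (6 + m) → Fin 3) (c-sym : ∀ x y → c x y ≡ c y x)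
  (noCopy : ¬ ZeroSumCopy T (c , c-sym)) where

  X : Set
  X = Fin (6 + m)

  freshVertex : (xs : List X) → {True (length xs ℕ.≤? 5)} → ∃ λ s → All (s ≢_) xs
  freshVertex xs {short} = fresh xs (≤-trans (s≤s (toWitness short)) (m≤m+n 6 m))

  nonzero : ∀ {φ} → Injective _≡_ _≡_ φ → weight T c φ % 3 ≢ 0
  nonzero φ-injective zeroSum = noCopy (_ , φ-injective , zeroSum)

  no-monochromatic-complement : ∀ {b r γ} → b ≢ r →
    ¬ (∀ {x y} → x ≢ b → x ≢ r → y ≢ b → y ≢ r → x ≢ y → c x y ≡ γ)
  no-monochromatic-complement b≢r monochromatic = nonzero injective (monochromatic-zeroSum T c e%3≡0
    λ {u} {v} uv → monochromatic (avoids₁ u) (avoids₂ u) (avoids₁ v) (avoids₂ v)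
                     (λ eq → irrefl T (subst (Adj T u) (sym (injective eq)) uv)))
    where open AvoidingEmbedding (embedding-avoiding [] [] b≢r [])

  cherries-monochromatic⇒⊥ : (∀ {P x y} → x ≢ P → y ≢ P → ¬ ¬ c P x ≡ c P y) → ⊥
  cherries-monochromatic⇒⊥ never = no-monochromatic-complement {zero} {suc zero} (λ ())
    λ _ _ _ _ → locally-constant⇒monochromatic c c-sym (λ _ → ⊤) constant {zero} {suc zero} tt tt (λ ()) tt tt
    where
    constant : ∀ {Q r₁ r₂} → ⊤ → ⊤ → ⊤ → r₁ ≢ Q → r₂ ≢ Q → c Q r₁ ≡ c Q r₂
    constant {Q} {r₁} {r₂} _ _ _ r₁≢Q r₂≢Q = decidable-stable (c Q r₁ ≟ c Q r₂) (never r₁≢Q r₂≢Q)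

  module LeafPair {ℓ p u q} (ℓ-leaf : Leaf T ℓ p) (u-leaf : Leaf T u q) (ℓ≢u : ℓ ≢ u) (p≢u : p ≢ u) where

    -- The copies φ, φ[ℓ ↦ b], φ[u ↦ r], φ[u ↦ r][ℓ ↦ b] have weights w, w + δ, w + ε, w + δ + ε,
    -- where δ is the change of colour at P and ε the one at Q; all four are nonzero.
    leaf-moves-rigid : ∀ {φ a P r₁ Q b r} → Injective _≡_ _≡_ φ → φ ℓ ≡ a → φ p ≡ P → φ u ≡ r₁ → φ q ≡ Q →
      (∀ i → φ i ≢ b) → (∀ i → φ i ≢ r) → b ≢ r → c P a ≢ c P b → c Q r₁ ≡ c Q r
    leaf-moves-rigid {φ} {b = b} {r} φ-injective refl refl refl refl φ≢b φ≢r b≢r bichromatic =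
      four-nonzero-weights (c (φ p) (φ ℓ)) (c (φ p) b) (c (φ q) (φ u)) (c (φ q) r) W W′ V bichromatic
        (nonzero′ φ-injective w₁) (nonzero′ φ₂-injective w₂) (nonzero′ φ₃-injective w₃) (nonzero′ φ₄-injective w₄)
        (trans (sym w₁) v₁) (trans (sym w₃) v₃)
      where
      φ₃ = updateAt φ u (const r)
      W  = weight (removeVertex T ℓ) c (φ ∘ punchIn ℓ)
      W′ = weight (removeVertex T ℓ) c (φ₃ ∘ punchIn ℓ)
      V  = weight (removeVertex T u) c (φ ∘ punchIn u)

      φ₃≡φ : ∀ {i} → i ≢ u → φ₃ i ≡ φ i
      φ₃≡φ {i} i≢u = updateAt-minimal i u φ i≢u

      w₁ : weight T c φ ≡ toℕ (c (φ p) (φ ℓ)) + W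
      w₁ = weight-removeLeaf T c c-sym ℓ-leaf φ
      w₂ : weight T c (updateAt φ ℓ (const b)) ≡ toℕ (c (φ p) b) + W
      w₂ = weight-moveLeaf T c c-sym ℓ-leaf φ b
      w₃ : weight T c φ₃ ≡ toℕ (c (φ p) (φ ℓ)) + W′
      w₃ = trans (weight-removeLeaf T c c-sym ℓ-leaf φ₃) (cong (λ k → toℕ k + W′) (cong₂ c (φ₃≡φ p≢u) (φ₃≡φ ℓ≢u)))
      w₄ : weight T c (updateAt φ₃ ℓ (const b)) ≡ toℕ (c (φ p) b) + W′
      w₄ = trans (weight-moveLeaf T c c-sym ℓ-leaf φ₃ b) (cong (λ x → toℕ (c x b) + W′) (φ₃≡φ p≢u))
      v₁ : weight T c φ ≡ toℕ (c (φ q) (φ u)) + V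
      v₁ = weight-removeLeaf T c c-sym u-leaf φ
      v₃ : weight T c φ₃ ≡ toℕ (c (φ q) r) + V
      v₃ = weight-moveLeaf T c c-sym u-leaf φ r

      φ₂-injective = updateAt-injective {i = ℓ} φ-injective φ≢b
      φ₃-injective = updateAt-injective {i = u} φ-injective φ≢r
      φ₄-injective = updateAt-injective {i = ℓ} φ₃-injective (updateAt-avoids {i = u} φ≢b (b≢r ∘ sym))

      nonzero′ : ∀ {ψ k} → Injective _≡_ _≡_ ψ → weight T c ψ ≡ k → k % 3 ≢ 0
      nonzero′ ψ-injective eq = nonzero ψ-injective ∘ trans (cong (_% 3) eq)

  module NonStar {ℓ p u q} (ℓ-leaf : Leaf T ℓ p) (u-leaf : Leaf T u q)
                 (ℓ≢u : ℓ ≢ u) (ℓ≢q : ℓ ≢ q) (p≢u : p ≢ u) (p≢q : p ≢ q) where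
    open LeafPair ℓ-leaf u-leaf ℓ≢u p≢u

    disjoint-cherries : ∀ {P a b Q r₁ r₂} → a ≢ P → b ≢ P → r₁ ≢ Q → r₂ ≢ Q →
      All (λ v → All (v ≢_) (Q ∷ r₁ ∷ r₂ ∷ [])) (P ∷ a ∷ b ∷ []) → c P a ≢ c P b → c Q r₁ ≡ c Q r₂
    disjoint-cherries {P} {a} {b} {Q} {r₁} {r₂} a≢P b≢P r₁≢Q r₂≢Q
      ((P≢Q ∷ P≢r₁ ∷ P≢r₂ ∷ []) ∷ (a≢Q ∷ a≢r₁ ∷ a≢r₂ ∷ []) ∷ (b≢Q ∷ b≢r₁ ∷ b≢r₂ ∷ []) ∷ []) bichromatic
      with r₁ ≟ r₂
    ... | yes refl = refl
    ... | no r₁≢r₂ = conclude (embedding-avoiding ((ℓ , a) ∷ (p , P) ∷ (u , r₁) ∷ (q , Q) ∷ [])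
          ( ((leaf≢parent ℓ-leaf , a≢P) ∷ (ℓ≢u , a≢r₁) ∷ (ℓ≢q , a≢Q) ∷ [])
          ∷ ((p≢u , P≢r₁) ∷ (p≢q , P≢Q) ∷ []) ∷ ((leaf≢parent u-leaf , r₁≢Q) ∷ []) ∷ [] ∷ [])
          b≢r₂
          ((a≢b , a≢r₂) ∷ (≢-sym b≢P , P≢r₂) ∷ (≢-sym b≢r₁ , r₁≢r₂) ∷ (≢-sym b≢Q , ≢-sym r₂≢Q) ∷ []))
      where
      a≢b : a ≢ b
      a≢b a≡b = bichromatic (cong (c P) a≡b)
      conclude : AvoidingEmbedding ((ℓ , a) ∷ (p , P) ∷ (u , r₁) ∷ (q , Q) ∷ []) b r₂ → c Q r₁ ≡ c Q r₂
      conclude e with AvoidingEmbedding.realises e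
      ... | φℓ ∷ φp ∷ φu ∷ φq ∷ [] = leaf-moves-rigid injective φℓ φp φu φq avoids₁ avoids₂ b≢r₂ bichromatic
        where open AvoidingEmbedding e

    module Obstruction {P z z̄} (z≢P : z ≢ P) (z̄≢P : z̄ ≢ P) (bichromatic : c P z ≢ c P z̄) where

      Outside : X → Set
      Outside v = v ≢ P × v ≢ z × v ≢ z̄

      outside-constant : ∀ {Q r₁ r₂} → Outside Q → Outside r₁ → Outside r₂ → r₁ ≢ Q → r₂ ≢ Q → c Q r₁ ≡ c Q r₂
      outside-constant (Q≢P , Q≢z , Q≢z̄) (r₁≢P , r₁≢z , r₁≢z̄) (r₂≢P , r₂≢z , r₂≢z̄) r₁≢Q r₂≢Q =
        disjoint-cherries z≢P z̄≢P r₁≢Q r₂≢Q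
          ( (≢-sym Q≢P ∷ ≢-sym r₁≢P ∷ ≢-sym r₂≢P ∷ []) ∷ (≢-sym Q≢z ∷ ≢-sym r₁≢z ∷ ≢-sym r₂≢z ∷ [])
          ∷ (≢-sym Q≢z̄ ∷ ≢-sym r₁≢z̄ ∷ ≢-sym r₂≢z̄ ∷ []) ∷ [])
          bichromatic

      module _ {t₁ t₂} (t₁-outside : Outside t₁) (t₂-outside : Outside t₂) (t₁≢t₂ : t₁ ≢ t₂) where

        outside-monochromatic : ∀ {u v} → Outside u → Outside v → u ≢ v → c u v ≡ c t₁ t₂
        outside-monochromatic =
          locally-constant⇒monochromatic c c-sym Outside outside-constant t₁-outside t₂-outside t₁≢t₂

        z-joins⇒⊥ : (∀ {r} → Outside r → c z r ≡ c t₁ t₂) → ⊥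
        z-joins⇒⊥ joins = no-monochromatic-complement (≢-sym z̄≢P) monochromatic
          where
          monochromatic : ∀ {x y} → x ≢ P → x ≢ z̄ → y ≢ P → y ≢ z̄ → x ≢ y → c x y ≡ c t₁ t₂
          monochromatic {x} {y} x≢P x≢z̄ y≢P y≢z̄ x≢y with x ≟ z | y ≟ z
          ... | yes refl | _        = joins (y≢P , ≢-sym x≢y , y≢z̄)
          ... | no x≢z   | yes refl = trans (c-sym x z) (joins (x≢P , x≢z , x≢z̄))
          ... | no x≢z   | no y≢z   = outside-monochromatic (x≢P , x≢z , x≢z̄) (y≢P , y≢z , y≢z̄) x≢y

        -- If c z r leaves the outside colour, (r; z, r′) is a bichromatic cherry disjoint from (P; z̄, s).
        blocked : ∀ {r} → Outside r → c z r ≢ c t₁ t₂ → ∀ {s} → Outside s → s ≢ r → c P s ≡ c P z̄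
        blocked {r} r-outside@(r≢P , r≢z , r≢z̄) czr≢γ {s} (s≢P , s≢z , s≢z̄) s≢r
          with freshVertex (P ∷ z ∷ z̄ ∷ r ∷ s ∷ [])
        ... | r′ , r′≢P ∷ r′≢z ∷ r′≢z̄ ∷ r′≢r ∷ r′≢s ∷ [] = sym (disjoint-cherries (≢-sym r≢z) r′≢r z̄≢P s≢P
              ( (r≢P ∷ r≢z̄ ∷ ≢-sym s≢r ∷ []) ∷ (z≢P ∷ (λ z≡z̄ → bichromatic (cong (c P) z≡z̄)) ∷ ≢-sym s≢z ∷ [])
              ∷ (r′≢P ∷ r′≢z̄ ∷ r′≢s ∷ []) ∷ [])
              λ crz≡crr′ → czr≢γ (trans (c-sym z r)
                (trans crz≡crr′ (outside-monochromatic r-outside (r′≢P , r′≢z , r′≢z̄) (≢-sym r′≢r)))))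

        obstruction : ∃ λ r → Outside r × ∀ {s} → Outside s → s ≢ r → c P s ≡ c P z̄
        obstruction with any? (λ r → ¬? (r ≟ P) ×-dec ¬? (r ≟ z) ×-dec ¬? (r ≟ z̄) ×-dec ¬? (c z r ≟ c t₁ t₂))
        ... | yes (r , r≢P , r≢z , r≢z̄ , czr≢γ) = r , (r≢P , r≢z , r≢z̄) , blocked (r≢P , r≢z , r≢z̄) czr≢γ
        ... | no noneOff = ⊥-elim (z-joins⇒⊥ λ {r} (r≢P , r≢z , r≢z̄) →
                decidable-stable (c z r ≟ c t₁ t₂) (λ czr≢γ → noneOff (r , r≢P , r≢z , r≢z̄ , czr≢γ)))

    -- The obstructions for z = x and for z = y make P see a common outside vertex s in both c P y and c P x.
    bichromatic⇒⊥ : ∀ {P x y} → x ≢ P → y ≢ P → c P x ≢ c P y → ⊥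
    bichromatic⇒⊥ {P} {x} {y} x≢P y≢P cPx≢cPy
      with freshVertex (P ∷ x ∷ y ∷ [])
    ... | t₁ , t₁≢P ∷ t₁≢x ∷ t₁≢y ∷ [] with freshVertex (P ∷ x ∷ y ∷ t₁ ∷ [])
    ... | t₂ , t₂≢P ∷ t₂≢x ∷ t₂≢y ∷ t₂≢t₁ ∷ []
      with Obstruction.obstruction x≢P y≢P cPx≢cPy (t₁≢P , t₁≢x , t₁≢y) (t₂≢P , t₂≢x , t₂≢y) (≢-sym t₂≢t₁)
         | Obstruction.obstruction y≢P x≢P (≢-sym cPx≢cPy) (t₁≢P , t₁≢y , t₁≢x) (t₂≢P , t₂≢y , t₂≢x) (≢-sym t₂≢t₁)
    ... | rₓ , (rₓ≢P , rₓ≢x , rₓ≢y) , cPs≡cPy | r_y , (r_y≢P , r_y≢y , r_y≢x) , cPs≡cPx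
      with freshVertex (P ∷ x ∷ y ∷ rₓ ∷ r_y ∷ [])
    ... | s , s≢P ∷ s≢x ∷ s≢y ∷ s≢rₓ ∷ s≢r_y ∷ [] =
      cPx≢cPy (trans (sym (cPs≡cPx (s≢P , s≢y , s≢x) s≢r_y)) (cPs≡cPy (s≢P , s≢x , s≢y) s≢rₓ))

  module StarCase {ℓ p u} (ℓ-leaf : Leaf T ℓ p) (u-leaf : Leaf T u p) (ℓ≢u : ℓ ≢ u) (star : Star T p) where
    open LeafPair ℓ-leaf u-leaf ℓ≢u (≢-sym (leaf≢parent u-leaf))

    same-centre-cherries : ∀ {P a b r₁ r₂} → a ≢ P → b ≢ P → r₁ ≢ P → r₂ ≢ P →
      All (λ v → All (v ≢_) (r₁ ∷ r₂ ∷ [])) (a ∷ b ∷ []) → c P a ≢ c P b → c P r₁ ≡ c P r₂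
    same-centre-cherries {P} {a} {b} {r₁} {r₂} a≢P b≢P r₁≢P r₂≢P
      ((a≢r₁ ∷ a≢r₂ ∷ []) ∷ (b≢r₁ ∷ b≢r₂ ∷ []) ∷ []) bichromatic
      with r₁ ≟ r₂
    ... | yes refl = refl
    ... | no r₁≢r₂ = conclude (embedding-avoiding ((ℓ , a) ∷ (p , P) ∷ (u , r₁) ∷ [])
          ( ((leaf≢parent ℓ-leaf , a≢P) ∷ (ℓ≢u , a≢r₁) ∷ []) ∷ ((≢-sym (leaf≢parent u-leaf) , ≢-sym r₁≢P) ∷ [])
          ∷ [] ∷ [])
          b≢r₂
          ((a≢b , a≢r₂) ∷ (≢-sym b≢P , ≢-sym r₂≢P) ∷ (≢-sym b≢r₁ , r₁≢r₂) ∷ []))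
      where
      a≢b : a ≢ b
      a≢b a≡b = bichromatic (cong (c P) a≡b)
      conclude : AvoidingEmbedding ((ℓ , a) ∷ (p , P) ∷ (u , r₁) ∷ []) b r₂ → c P r₁ ≡ c P r₂
      conclude e with AvoidingEmbedding.realises e
      ... | φℓ ∷ φp ∷ φu ∷ [] = leaf-moves-rigid injective φℓ φp φu φp avoids₁ avoids₂ b≢r₂ bichromatic
        where open AvoidingEmbedding e

    no-monochromatic-star : ∀ {P b κ} → b ≢ P → ¬ (∀ {r} → r ≢ P → r ≢ b → c P r ≡ κ)
    no-monochromatic-star {P} {b} {κ} b≢P monochromatic with freshVertex (P ∷ b ∷ [])
    ... | o , o≢P ∷ o≢b ∷ [] = nonzero injective (monochromatic-zeroSum T c e%3≡0 edge-colour)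
      where
      open AvoidingEmbedding (embedding-avoiding ((p , P) ∷ []) ([] ∷ []) (≢-sym o≢b) ((≢-sym b≢P , ≢-sym o≢P) ∷ []))
      φp≡P : φ p ≡ P
      φp≡P with realises
      ... | φp≡P ∷ [] = φp≡P
      centre : ∀ {v} → Adj T p v → c (φ p) (φ v) ≡ κ
      centre {v} pv = trans (cong (λ x → c x (φ v)) φp≡P)
        (monochromatic (λ eq → irrefl T (subst (Adj T p) (injective (trans eq (sym φp≡P))) pv)) (avoids₁ v))
      edge-colour : ∀ {v w} → Adj T v w → c (φ v) (φ w) ≡ κ
      edge-colour {v} {w} vw with star vw
      ... | inj₁ refl = centre vw
      ... | inj₂ refl = trans (c-sym (φ v) (φ p)) (centre (Graph.sym T vw))

    -- P sees all vertices but x, y in one colour c P t. If it sees x or y in that colour as well, there is a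
    -- monochromatic star at P; otherwise (P; x, t) and (P; y, t′) are both bichromatic.
    bichromatic⇒⊥ : ∀ {P x y} → x ≢ P → y ≢ P → c P x ≢ c P y → ⊥
    bichromatic⇒⊥ {P} {x} {y} x≢P y≢P cPx≢cPy with freshVertex (P ∷ x ∷ y ∷ [])
    ... | t , t≢P ∷ t≢x ∷ t≢y ∷ [] with freshVertex (P ∷ x ∷ y ∷ t ∷ [])
    ... | t′ , t′≢P ∷ t′≢x ∷ t′≢y ∷ t′≢t ∷ [] = cases (c P x ≟ c P t) (c P y ≟ c P t)
      where
      rest : ∀ {r} → r ≢ P → r ≢ x → r ≢ y → c P r ≡ c P t
      rest r≢P r≢x r≢y = same-centre-cherries x≢P y≢P r≢P t≢P
        ((≢-sym r≢x ∷ ≢-sym t≢x ∷ []) ∷ (≢-sym r≢y ∷ ≢-sym t≢y ∷ []) ∷ []) cPx≢cPy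
      joins : ∀ {z z̄} → z̄ ≢ P → c P z ≡ c P t → (∀ {r} → r ≢ P → r ≢ z → r ≢ z̄ → c P r ≡ c P t) → ⊥
      joins {z} {z̄} z̄≢P cPz≡κ rest′ = no-monochromatic-star z̄≢P colour
        where
        colour : ∀ {r} → r ≢ P → r ≢ z̄ → c P r ≡ c P t
        colour {r} r≢P r≢z̄ with r ≟ z
        ... | yes refl = cPz≡κ
        ... | no r≢z   = rest′ r≢P r≢z r≢z̄
      cases : Dec (c P x ≡ c P t) → Dec (c P y ≡ c P t) → ⊥
      cases (yes cPx≡κ) _           = joins y≢P cPx≡κ rest
      cases (no _)      (yes cPy≡κ) = joins x≢P cPy≡κ (λ r≢P r≢y r≢x → rest r≢P r≢x r≢y)
      cases (no cPx≢κ)  (no cPy≢κ)  = cPy≢κ (trans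
        (same-centre-cherries x≢P t≢P y≢P t′≢P
          ((x≢y ∷ ≢-sym t′≢x ∷ []) ∷ (t≢y ∷ ≢-sym t′≢t ∷ []) ∷ []) cPx≢κ)
        (rest t′≢P t′≢x t′≢y))
        where
        x≢y : x ≢ y
        x≢y x≡y = cPx≢cPy (cong (c P) x≡y)

  not-a-tree : ¬ IsTree T
  not-a-tree tree@(connected , acyclic) with leaf-exists T acyclic connected {zero} {suc zero} (λ ())
  ... | ℓ , p , ℓ-leaf with disjointLeaf-or-star T tree ℓ-leaf
  ... | inj₁ far = cherries-monochromatic⇒⊥ (NonStar.bichromatic⇒⊥ ℓ-leaf isLeaf ℓ≢end ℓ≢parent p≢end p≢parent)
    where open DisjointLeaf far
  ... | inj₂ star with fresh (ℓ ∷ p ∷ []) (s≤s (s≤s (s≤s z≤n)))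
  ... | u , u≢ℓ ∷ u≢p ∷ [] =
    cherries-monochromatic⇒⊥ (StarCase.bichromatic⇒⊥ ℓ-leaf (star-leaf T connected star u≢p) (≢-sym u≢ℓ) star)

corollary8 : (n : ℕ) → (T : Graph n) → IsTree T → n % 3 ≡ 1 → RamseyZ3≤ T (n + 2)
corollary8 0 _ _ ()
corollary8 1 _ _ _ 0       () _
corollary8 1 _ _ _ (ℕ.suc N) _ _ = (λ _ → zero) , (λ { {zero} {zero} _ → refl }) , refl
corollary8 2 _ _ ()
corollary8 3 _ _ ()
corollary8 n@(ℕ.suc (ℕ.suc (ℕ.suc (ℕ.suc m)))) T tree n%3≡1 N n+2≤N f@(c , c-sym) =
  zeroSumCopy-restrict T 2+n≤N f (decidable-stable (zeroSumCopy? T (c′ , c′-sym))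
    (λ noCopy → NoZeroSumCopy.not-a-tree T e%3≡0 c′ c′-sym noCopy tree))
  where
  2+n≤N : 2 + n ≤ N
  2+n≤N = subst (_≤ N) (+-comm n 2) n+2≤N
  c′ : Fin (2 + n) → Fin (2 + n) → Fin 3
  c′ i j = c (inject≤ i 2+n≤N) (inject≤ j 2+n≤N)
  c′-sym : ∀ i j → c′ i j ≡ c′ j i
  c′-sym i j = c-sym (inject≤ i 2+n≤N) (inject≤ j 2+n≤N)
  e%3≡0 : e T % 3 ≡ 0
  e%3≡0 = trans (cong (_% 3) (e-tree (3 + m) T tree)) (pred-%3 (3 + m) n%3≡1)
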